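{- Let $m\ge 4$ and let $\varphi=(\mathcal A_1,\dots,\mathcal A_m)$ be a ring (as defined in the context), with indices taken modulo $m$. Then $\varphi$ is unbalanced if and only if there exists $i\in\{1,\dots,m\}$ such that $|\mathcal A_i|<\lfloor m/2\rfloor$ and $|\mathcal A_{i-1}|+|\mathcal A_i|\le 2\lfloor m/2\rfloor$.
   Context: Indices are taken cyclically modulo $m$. A ring is a sequence $\varphi=(\mathcal A_1,\dots,\mathcal A_m)$ of pairwise disjoint finite vertex sets such that $|\mathcal A_i|\ge 1$ and $|\mathcal A_i|+|\mathcal A_{i+1}|\le m$ for all $i$, and $\sum_{i=1}^m|\mathcal A_i| = m\lfloor m/2\rfloor$. The ring graph has vertex set $\bigcup_i\mathcal A_i$, two distinct vertices $u\in\mathcal A_i$, $v\in\mathcal A_j$ being adjacent iff $j\in\{i-1,i,i+1\}$ modulo $m$ (so each $\mathcal A_i\cup\mathcal A_{i+1}$ is a clique). A ring is balanced if $|\mathcal A_i|=\lfloor m/2\rfloor$ for all $i$, and unbalanced otherwise. -}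

module Defs where

open import Data.Nat using (ℕ; zero; suc; _+_; _*_; _≤_; _<_; _/_)
open import Data.Nat.DivMod using (_mod_)
open import Data.Fin using (Fin; toℕ)
open import Data.List using (List; length; tabulate)
open import Data.Nat.ListAction using (sum)
open import Data.List.Membership.Propositional using (_∈_)
open import Data.List.Relation.Unary.Unique.Propositional using (Unique)
open import Data.Product using (_×_)
open import Relation.Binary.PropositionalEquality using (_≡_)
open import Relation.Nullary using (¬_)
open import Data.Empty using (⊥)

-- Indices 1..m are represented by Fin m (0..m-1); m = suc n.
-- cyclic successor i+1 and predecessor i-1 modulo m
csuc : ∀ {n} → Fin (suc n) → Fin (suc n)
csuc {n} i = suc (toℕ i) mod (suc n)

cpred : ∀ {n} → Fin (suc n) → Fin (suc n)
cpred {n} i = (toℕ i + n) mod (suc n)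

-- A finite vertex set is a duplicate-free list of vertices; its size is the length.
FinSet : Set → Set
FinSet V = List V

∣_∣ : ∀ {V : Set} → List V → ℕ
∣ xs ∣ = length xs

Σ[_] : ∀ {m} → (Fin m → ℕ) → ℕ
Σ[ f ] = sum (tabulate f)

record IsRing {V : Set} (n : ℕ) (A : Fin (suc n) → List V) : Set where
  field
    finiteSets : ∀ i → Unique (A i)
    disjoint   : ∀ i j → ¬ (i ≡ j) → ∀ v → v ∈ A i → v ∈ A j → ⊥
    nonempty   : ∀ i → 1 ≤ ∣ A i ∣
    adjBound   : ∀ i → ∣ A i ∣ + ∣ A (csuc i) ∣ ≤ suc n
    total      : Σ[ (λ i → ∣ A i ∣) ] ≡ suc n * (suc n / 2)

Balanced : ∀ {V : Set} (n : ℕ) (A : Fin (suc n) → List V) → Set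
Balanced n A = ∀ i → ∣ A i ∣ ≡ suc n / 2

Unbalanced : ∀ {V : Set} (n : ℕ) (A : Fin (suc n) → List V) → Set
Unbalanced n A = ¬ Balanced n A

-- Raise every size to at least k = ⌊m/2⌋: the raised sizes sum to m·k plus the total deficit
-- Σ (k ∸ |A_i|). Every set carries at least k + (k ∸ |A_{i+1}|) after raising: trivially if its
-- successor has no deficit, and strictly so if the successor is deficient but |A_i| + |A_{i+1}| > 2k.
-- Summing over the rotated indices, one deficient set with no light pair would make the raised
-- total exceed itself. Hence no set is below k, and the total m·k forces every size to equal k.
module Submission where

open import Defs
open import Data.Empty using (⊥-elim)
open import Data.Fin using (Fin; toℕ; inject₁; fromℕ; fromℕ<) renaming (zero to fzero; suc to fsuc)
open import Data.Fin.Properties using (toℕ-injective; toℕ-fromℕ<; toℕ-fromℕ; toℕ-inject₁; toℕ<n; any?)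
open import Data.List using (List)
open import Data.List.Properties using (tabulate-cong)
open import Data.Nat using (ℕ; zero; suc; _+_; _*_; _∸_; _⊔_; _≤_; _<_; _/_; _≤?_; _<?_; z≤n)
open import Data.Nat.DivMod using (_mod_; _%_; [m+n]%n≡m%n; m<n⇒m%n≡m; m%n<n)
open import Data.Nat.ListAction using (sum)
open import Data.Nat.Properties
open import Algebra.Properties.CommutativeSemigroup +-commutativeSemigroup using (interchange)
open import Data.Product using (_×_; ∃-syntax; _,_)
open import Data.Sum using (inj₁; inj₂)
open import Function.Bundles using (_⇔_; mk⇔)
open import Relation.Binary.PropositionalEquality
open import Relation.Nullary using (yes; no)
open import Relation.Nullary.Decidable using (_×-dec_)

Σ-cong : ∀ {m} {f g : Fin m → ℕ} → (∀ i → f i ≡ g i) → Σ[ f ] ≡ Σ[ g ]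
Σ-cong f≗g = cong sum (tabulate-cong f≗g)

Σ-distrib-+ : ∀ {m} (f g : Fin m → ℕ) → Σ[ (λ i → f i + g i) ] ≡ Σ[ f ] + Σ[ g ]
Σ-distrib-+ {zero}  f g = refl
Σ-distrib-+ {suc m} f g = begin
  f fzero + g fzero + Σ[ (λ i → f (fsuc i) + g (fsuc i)) ]
    ≡⟨ cong (f fzero + g fzero +_) (Σ-distrib-+ (λ i → f (fsuc i)) (λ i → g (fsuc i))) ⟩
  f fzero + g fzero + (Σ[ (λ i → f (fsuc i)) ] + Σ[ (λ i → g (fsuc i)) ])
    ≡⟨ interchange (f fzero) (g fzero) _ _ ⟩
  Σ[ f ] + Σ[ g ] ∎
  where open ≡-Reasoning

Σ-const : ∀ m k → Σ[ (λ (_ : Fin m) → k) ] ≡ m * k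
Σ-const zero    k = refl
Σ-const (suc m) k = cong (k +_) (Σ-const m k)

Σ-mono-≤ : ∀ {m} {f g : Fin m → ℕ} → (∀ i → f i ≤ g i) → Σ[ f ] ≤ Σ[ g ]
Σ-mono-≤ {zero}  f≤g = z≤n
Σ-mono-≤ {suc m} f≤g = +-mono-≤ (f≤g fzero) (Σ-mono-≤ (λ i → f≤g (fsuc i)))

Σ-mono-< : ∀ {m} {f g : Fin m → ℕ} → (∀ i → f i ≤ g i) → ∀ j → f j < g j → Σ[ f ] < Σ[ g ]
Σ-mono-< {suc m} f≤g fzero    fj<gj = +-mono-<-≤ fj<gj (Σ-mono-≤ (λ i → f≤g (fsuc i)))
Σ-mono-< {suc m} f≤g (fsuc j) fj<gj = +-mono-≤-< (f≤g fzero) (Σ-mono-< (λ i → f≤g (fsuc i)) j fj<gj)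

Σ-init-last : ∀ n (f : Fin (suc n) → ℕ) → Σ[ f ] ≡ Σ[ (λ i → f (inject₁ i)) ] + f (fromℕ n)
Σ-init-last zero    f = +-comm (f fzero) 0
Σ-init-last (suc n) f = begin
  f fzero + Σ[ (λ i → f (fsuc i)) ]
    ≡⟨ cong (f fzero +_) (Σ-init-last n (λ i → f (fsuc i))) ⟩
  f fzero + (Σ[ (λ i → f (fsuc (inject₁ i))) ] + f (fromℕ (suc n)))
    ≡⟨ +-assoc (f fzero) _ _ ⟨
  Σ[ (λ i → f (inject₁ i)) ] + f (fromℕ (suc n)) ∎
  where open ≡-Reasoning

cpred-zero : ∀ n → cpred {n} fzero ≡ fromℕ n
cpred-zero n = toℕ-injective (begin
  toℕ ((0 + n) mod suc n) ≡⟨ toℕ-fromℕ< (m%n<n n (suc n)) ⟩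
  n % suc n               ≡⟨ m<n⇒m%n≡m (n<1+n n) ⟩
  n                       ≡⟨ toℕ-fromℕ n ⟨
  toℕ (fromℕ n)           ∎)
  where open ≡-Reasoning

cpred-suc : ∀ n (i : Fin n) → cpred {n} (fsuc i) ≡ inject₁ i
cpred-suc n i = toℕ-injective (begin
  toℕ ((suc (toℕ i) + n) mod suc n) ≡⟨ toℕ-fromℕ< (m%n<n (suc (toℕ i) + n) (suc n)) ⟩
  (suc (toℕ i) + n) % suc n         ≡⟨ cong (_% suc n) (+-suc (toℕ i) n) ⟨
  (toℕ i + suc n) % suc n           ≡⟨ [m+n]%n≡m%n (toℕ i) (suc n) ⟩
  toℕ i % suc n                     ≡⟨ m<n⇒m%n≡m (m<n⇒m<1+n (toℕ<n i)) ⟩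
  toℕ i                             ≡⟨ toℕ-inject₁ i ⟨
  toℕ (inject₁ i)                   ∎)
  where open ≡-Reasoning

Σ-∘cpred : ∀ n (f : Fin (suc n) → ℕ) → Σ[ (λ i → f (cpred i)) ] ≡ Σ[ f ]
Σ-∘cpred n f = begin
  f (cpred fzero) + Σ[ (λ i → f (cpred (fsuc i))) ]
    ≡⟨ cong₂ _+_ (cong f (cpred-zero n)) (Σ-cong (λ i → cong f (cpred-suc n i))) ⟩
  f (fromℕ n) + Σ[ (λ i → f (inject₁ i)) ] ≡⟨ +-comm (f (fromℕ n)) _ ⟩
  Σ[ (λ i → f (inject₁ i)) ] + f (fromℕ n) ≡⟨ Σ-init-last n f ⟨
  Σ[ f ]                                   ∎
  where open ≡-Reasoning

m⊔n≡m+[n∸m] : ∀ m n → m ⊔ n ≡ m + (n ∸ m)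
m⊔n≡m+[n∸m] m n with ≤-total m n
... | inj₁ m≤n = trans (m≤n⇒m⊔n≡n m≤n) (sym (m+[n∸m]≡n m≤n))
... | inj₂ n≤m = begin
  m ⊔ n       ≡⟨ m≥n⇒m⊔n≡m n≤m ⟩
  m           ≡⟨ +-identityʳ m ⟨
  m + 0       ≡⟨ cong (m +_) (m≤n⇒m∸n≡0 n≤m) ⟨
  m + (n ∸ m) ∎
  where open ≡-Reasoning

compensated-< : ∀ k x y → y < k → 2 * k < x + y → k + (k ∸ y) < x ⊔ k
compensated-< k x y y<k 2k<x+y = <-≤-trans k+[k∸y]<x (m≤m⊔n x k)
  where
  k+[k∸y]+y≡2k : k + (k ∸ y) + y ≡ 2 * k
  k+[k∸y]+y≡2k = begin
    k + (k ∸ y) + y   ≡⟨ +-assoc k (k ∸ y) y ⟩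
    k + (k ∸ y + y)   ≡⟨ cong (k +_) (m∸n+n≡m (<⇒≤ y<k)) ⟩
    k + k             ≡⟨ cong (k +_) (+-identityʳ k) ⟨
    2 * k             ∎
    where open ≡-Reasoning
  k+[k∸y]<x : k + (k ∸ y) < x
  k+[k∸y]<x = +-cancelʳ-< y _ x (subst (_< x + y) (sym k+[k∸y]+y≡2k) 2k<x+y)

compensated-≤ : ∀ k x y → (y < k → 2 * k < x + y) → k + (k ∸ y) ≤ x ⊔ k
compensated-≤ k x y compensation with y <? k
... | yes y<k = <⇒≤ (compensated-< k x y y<k (compensation y<k))
... | no  y≮k = begin
  k + (k ∸ y) ≡⟨ cong (k +_) (m≤n⇒m∸n≡0 (≮⇒≥ y≮k)) ⟩
  k + 0       ≡⟨ +-identityʳ k ⟩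
  k           ≤⟨ m≤n⊔m x k ⟩
  x ⊔ k       ∎
  where open ≤-Reasoning

compensated⇒all≥ : ∀ {n} k (a : Fin (suc n) → ℕ) → Σ[ a ] ≡ suc n * k →
                   (∀ i → a i < k → 2 * k < a (cpred i) + a i) → ∀ i → k ≤ a i
compensated⇒all≥ {n} k a Σa≡ compensation j = ≮⇒≥ λ aj<k → <-irrefl lower≡raised (lower<raised aj<k)
  where
  deficit : Fin (suc n) → ℕ
  deficit i = k ∸ a i
  lower<raised : a j < k → Σ[ (λ i → k + deficit i) ] < Σ[ (λ i → a (cpred i) ⊔ k) ]
  lower<raised aj<k =
    Σ-mono-< (λ i → compensated-≤ k _ _ (compensation i)) j (compensated-< k _ _ aj<k (compensation j aj<k))
  lower≡raised : Σ[ (λ i → k + deficit i) ] ≡ Σ[ (λ i → a (cpred i) ⊔ k) ]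
  lower≡raised = begin
    Σ[ (λ i → k + deficit i) ]
      ≡⟨ Σ-distrib-+ (λ _ → k) deficit ⟩
    Σ[ (λ (_ : Fin (suc n)) → k) ] + Σ[ deficit ]
      ≡⟨ cong (_+ Σ[ deficit ]) (trans (Σ-const (suc n) k) (sym Σa≡)) ⟩
    Σ[ a ] + Σ[ deficit ]           ≡⟨ Σ-distrib-+ a deficit ⟨
    Σ[ (λ i → a i + deficit i) ]    ≡⟨ Σ-cong (λ i → m⊔n≡m+[n∸m] (a i) k) ⟨
    Σ[ (λ i → a i ⊔ k) ]            ≡⟨ Σ-∘cpred n (λ i → a i ⊔ k) ⟨
    Σ[ (λ i → a (cpred i) ⊔ k) ]    ∎
    where open ≡-Reasoning

Σ≡*∧all≥⇒all≡ : ∀ {m} k (a : Fin m → ℕ) → Σ[ a ] ≡ m * k → (∀ i → k ≤ a i) → ∀ i → a i ≡ k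
Σ≡*∧all≥⇒all≡ {m} k a Σa≡ k≤a i = ≤-antisym (≮⇒≥ λ k<ai → <-irrefl Σk≡Σa (Σ-mono-< k≤a i k<ai)) (k≤a i)
  where
  Σk≡Σa : Σ[ (λ (_ : Fin m) → k) ] ≡ Σ[ a ]
  Σk≡Σa = trans (Σ-const m k) (sym Σa≡)

lemma2p4 : {V : Set} (n : ℕ) → 4 ≤ suc n → (A : Fin (suc n) → List V) → IsRing n A →
    Unbalanced n A ⇔ (∃[ i ] (∣ A i ∣ < suc n / 2 × ∣ A (cpred i) ∣ + ∣ A i ∣ ≤ 2 * (suc n / 2)))
lemma2p4 n _ A ring = mk⇔ unbalanced⇒witness witness⇒unbalanced
  where
  k = suc n / 2
  a : Fin (suc n) → ℕ
  a i = ∣ A i ∣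
  witness⇒unbalanced : ∃[ i ] (a i < k × a (cpred i) + a i ≤ 2 * k) → Unbalanced n A
  witness⇒unbalanced (i , ai<k , _) balanced = <-irrefl (balanced i) ai<k
  unbalanced⇒witness : Unbalanced n A → ∃[ i ] (a i < k × a (cpred i) + a i ≤ 2 * k)
  unbalanced⇒witness unbalanced with any? (λ i → (a i <? k) ×-dec (a (cpred i) + a i ≤? 2 * k))
  ... | yes witness = witness
  ... | no  none    = ⊥-elim (unbalanced (Σ≡*∧all≥⇒all≡ k a total (compensated⇒all≥ k a total compensation)))
    where
    total = IsRing.total ring
    compensation : ∀ i → a i < k → 2 * k < a (cpred i) + a i
    compensation i ai<k = ≰⇒> λ light → none (i , ai<k , light)
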